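{- For every connected graph $G$, $b_{\mathsf{fa}}(G)\leq 2\, b(G)$, where $b(G)=\max_{s\in V(G)} b(G,s)$.
   Context: Broadcasting in a connected graph $G$: initially only a source vertex $s$ holds a message; time proceeds in synchronous rounds, and in each round every informed vertex may transmit the message to at most one of its neighbors. $b(G,s)$ is the minimum number of rounds needed to inform all vertices from source $s$ using an arbitrary (source-dependent) protocol. Fully-adaptive source-oblivious model: each vertex $v$ is assigned a single ordered list $\ell_v$ of distinct neighbors of $v$ (independent of the source). Once $v$ is informed, in each subsequent round it sends the message to the first vertex of $\ell_v$ that is not already informed at the start of that round (informed neighbors are skipped); $v$ stops when all vertices in its list are informed. For lists $L=(\ell_v)_{v\in V(G)}$ and source $s$, $b_{\mathsf{fa}}(G,s,L)$ is the number of rounds until all vertices are informed, and $b_{\mathsf{fa}}(G)=\min_L\max_{s\in V(G)} b_{\mathsf{fa}}(G,s,L)$. -}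

module Defs where

open import Data.Nat using (ℕ; zero; suc)
open import Data.Fin using (Fin; _≟_)
open import Data.Bool using (Bool; true; false; _∨_; _∧_; if_then_else_)
open import Data.Maybe using (Maybe; just; nothing)
open import Data.List using (List; []; _∷_; allFin)
open import Data.Bool.ListAction using (any)
open import Data.List.Relation.Unary.All using (All)
open import Data.List.Relation.Unary.Unique.Propositional using (Unique)
open import Data.Vec using (Vec; []; _∷_)
import Data.Vec.Relation.Unary.All as VAll
open import Data.Product using (Σ; _×_)
open import Relation.Binary.PropositionalEquality using (_≡_)
open import Relation.Nullary.Decidable using (⌊_⌋)

record Graph (n : ℕ) : Set where
  field
    adj    : Fin n → Fin n → Bool
    sym    : ∀ u v → adj u v ≡ adj v u
    irrefl : ∀ v → adj v v ≡ false
open Graph public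

data Walk {n : ℕ} (G : Graph n) : Fin n → Fin n → Set where
  here  : ∀ {v} → Walk G v v
  there : ∀ {u w v} → adj G u w ≡ true → Walk G w v → Walk G u v

Connected : ∀ {n} → Graph n → Set
Connected {n} G = ∀ (u v : Fin n) → Walk G u v

Informed : ℕ → Set
Informed n = Fin n → Bool

only : ∀ {n} → Fin n → Informed n
only s w = ⌊ s ≟ w ⌋

AllInformed : ∀ {n} → Informed n → Set
AllInformed {n} I = ∀ (w : Fin n) → I w ≡ true

hits : ∀ {n} → Maybe (Fin n) → Fin n → Bool
hits (just x) w = ⌊ x ≟ w ⌋
hits nothing  w = false

-- Classical (source-dependent) broadcasting.
-- A round: every vertex v chooses at most one neighbour r v to call.
-- Only vertices informed at the start of the round actually transmit.

Round : ℕ → Set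
Round n = Fin n → Maybe (Fin n)

ValidRound : ∀ {n} → Graph n → Round n → Set
ValidRound {n} G r = ∀ (v w : Fin n) → r v ≡ just w → adj G v w ≡ true

step : ∀ {n} → Round n → Informed n → Informed n
step {n} r I w = I w ∨ any (λ v → I v ∧ hits (r v) w) (allFin n)

run : ∀ {n t} → Vec (Round n) t → Informed n → Informed n
run []       I = I
run (r ∷ rs) I = run rs (step r I)

BroadcastableIn : ∀ {n} → Graph n → Fin n → ℕ → Set
BroadcastableIn {n} G s t =
  Σ (Vec (Round n) t) λ rs → VAll.All (ValidRound G) rs × AllInformed (run rs (only s))

BroadcastTimeAtMost : ∀ {n} → Graph n → ℕ → Set
BroadcastTimeAtMost {n} G t = ∀ (s : Fin n) → BroadcastableIn G s t

Lists : ℕ → Set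
Lists n = Fin n → List (Fin n)

ValidLists : ∀ {n} → Graph n → Lists n → Set
ValidLists {n} G L = ∀ (v : Fin n) → Unique (L v) × All (λ w → adj G v w ≡ true) (L v)

firstUninformed : ∀ {n} → Informed n → List (Fin n) → Maybe (Fin n)
firstUninformed I []       = nothing
firstUninformed I (w ∷ ws) = if I w then firstUninformed I ws else just w

faStep : ∀ {n} → Lists n → Informed n → Informed n
faStep {n} L I w = I w ∨ any (λ v → I v ∧ hits (firstUninformed I (L v)) w) (allFin n)

faRun : ∀ {n} → Lists n → ℕ → Informed n → Informed n
faRun L zero    I = I
faRun L (suc k) I = faRun L k (faStep L I)

FACompletesWithin : ∀ {n} → Lists n → Fin n → ℕ → Set
FACompletesWithin L s T = AllInformed (faRun L T (only s))

FABroadcastTimeAtMost : ∀ {n} → Graph n → ℕ → Set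
FABroadcastTimeAtMost {n} G T =
  Σ (Lists n) λ L → ValidLists G L × (∀ (s : Fin n) → FACompletesWithin L s T)

-- Fix a protocol that informs everybody from a vertex r within t rounds, and remember for each
-- vertex the round in which it is first informed and by whom.  This is a spanning tree rooted at r
-- in which the children of a vertex are informed in distinct rounds, all later than the vertex
-- itself.  Every vertex lists its parent first and then its children in the order it called them.
-- From any source, the first call of each informed vertex goes to its parent, so the message
-- climbs to r within t rounds.  After that, by induction on j, a vertex informed within j rounds of
-- the protocol is informed within j further rounds: its parent and everything before it in the
-- parent's list were informed in fewer rounds of the protocol, hence are already informed, and are
-- skipped.
module Submission where

open import Defs hiding (sym)
open import Data.Bool using (Bool; true; false; _∨_; _∧_; if_then_else_)
open import Data.Bool.Properties using (T-≡; ∨-zeroʳ; ∨-identityʳ)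
open import Data.Bool.ListAction using (any)
open import Data.Empty using (⊥-elim)
import Data.Fin as Fin
open import Data.Fin using (Fin; _≟_)
open import Data.List using (List; []; _∷_; _++_; allFin; findᵇ; mapMaybe; upTo; fromMaybe)
open import Data.List.Membership.Propositional using (_∈_)
open import Data.List.Membership.Propositional.Properties using (∈-allFin; ∈-upTo⁺; ∈-∃++)
open import Data.List.Relation.Unary.All as All using (All; []; _∷_)
import Data.List.Relation.Unary.All.Properties as All
open import Data.List.Relation.Unary.AllPairs as AllPairs using (AllPairs; []; _∷_)
import Data.List.Relation.Unary.AllPairs.Properties as AllPairs
import Data.List.Relation.Unary.Any as Any
import Data.List.Relation.Unary.Any.Properties as Any
open import Data.Maybe using (Maybe; just; nothing; _<∣>_; _>>=_; when)
import Data.Maybe.Relation.Unary.Any as Maybe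
open import Data.Nat
  using (ℕ; zero; suc; _*_; _+_; _≤_; _<_; _≤′_; ≤′-reflexive; ≤′-step; _≡ᵇ_; z≤n; s≤s; z<s)
open import Data.Nat.Induction using (<-wellFounded)
open import Data.Nat.Properties
  using (≡ᵇ⇒≡; ≡⇒≡ᵇ; ≤⇒≤′; ≤-refl; ≤-reflexive; ≤-pred; <-irrefl; <-trans; <-≤-trans; ≤-<-trans;
         n≮0; m≤m+n; +-monoʳ-<; +-suc; +-identityʳ)
open import Data.Product using (∃-syntax; _×_; _,_; proj₁; proj₂)
open import Data.Vec using (Vec; []; _∷_)
import Data.Vec.Relation.Unary.All as Vec
open import Function using (_∘_; _on_; Equivalence)
open import Induction.WellFounded using (Acc; acc)
import Relation.Binary.Construct.On as On
open import Relation.Binary.PropositionalEquality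
open import Relation.Nullary.Decidable using (⌊_⌋; toWitness; fromWitness)

open Equivalence using (to; from)

∧≡true⁻ : ∀ {a b} → a ∧ b ≡ true → a ≡ true × b ≡ true
∧≡true⁻ {true} {true} refl = refl , refl

≡ᵇ-refl : ∀ m → (m ≡ᵇ m) ≡ true
≡ᵇ-refl m = to T-≡ (≡⇒≡ᵇ m m refl)

any-∈ : ∀ {A : Set} (p : A → Bool) {x xs} → x ∈ xs → p x ≡ true → any p xs ≡ true
any-∈ p x∈xs px = to T-≡ (Any.any⁺ p (Any.map (λ { refl → from T-≡ px }) x∈xs))

findᵇ-sound : ∀ {A : Set} (p : A → Bool) xs {x} → findᵇ p xs ≡ just x → p x ≡ true
findᵇ-sound p (y ∷ ys) e with p y in py
findᵇ-sound p (y ∷ ys) refl | true = py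
... | false = findᵇ-sound p ys e

findᵇ-nothing : ∀ {A : Set} (p : A → Bool) xs → findᵇ p xs ≡ nothing → any p xs ≡ false
findᵇ-nothing p []       e = refl
findᵇ-nothing p (y ∷ ys) e with p y
... | false = findᵇ-nothing p ys e

∈-mapMaybe⁺ : ∀ {A B : Set} (f : A → Maybe B) {x y xs} →
  x ∈ xs → f x ≡ just y → y ∈ mapMaybe f xs
∈-mapMaybe⁺ f {xs = xs} x∈xs fx = Any.mapMaybe⁺ f xs (Any.map⁺ (Any.map hit x∈xs))
  where
    hit : ∀ {x′} → _ ≡ x′ → Maybe.Any (_ ≡_) (f x′)
    hit refl = subst (Maybe.Any (_ ≡_)) (sym fx) (Maybe.just refl)

All-mapMaybe⁺ : ∀ {A B : Set} {Q : A → Set} {P : B → Set} (f : A → Maybe B) →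
  (∀ {x y} → Q x → f x ≡ just y → P y) → ∀ {xs} → All Q xs → All P (mapMaybe f xs)
All-mapMaybe⁺ f ok []                  = []
All-mapMaybe⁺ f ok {x ∷ xs} (Qx ∷ Qxs) with f x in fx
... | nothing = All-mapMaybe⁺ f ok Qxs
... | just y  = ok Qx fx ∷ All-mapMaybe⁺ f ok Qxs

AllPairs-mapMaybe⁺ : ∀ {A B : Set} {S : A → A → Set} {R : B → B → Set} (f : A → Maybe B) →
  (∀ {i j x y} → S i j → f i ≡ just x → f j ≡ just y → R x y) →
  ∀ {xs} → AllPairs S xs → AllPairs R (mapMaybe f xs)
AllPairs-mapMaybe⁺ f resp []                   = []
AllPairs-mapMaybe⁺ f resp {i ∷ is} (Si ∷ Sis) with f i in fi
... | nothing = AllPairs-mapMaybe⁺ f resp Sis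
... | just x  = All-mapMaybe⁺ f (λ Sij fj → resp Sij fi fj) Si ∷ AllPairs-mapMaybe⁺ f resp Sis

AllPairs-before : ∀ {A : Set} {R : A → A → Set} P {v Q} →
  AllPairs R (P ++ v ∷ Q) → All (λ x → R x v) P
AllPairs-before []      _          = []
AllPairs-before (x ∷ P) (Rx ∷ Rxs) = All.head (All.++⁻ʳ P Rx) ∷ AllPairs-before P Rxs

module _ {n : ℕ} where

  ≟⇒≡ : {x y : Fin n} → ⌊ x ≟ y ⌋ ≡ true → x ≡ y
  ≟⇒≡ e = toWitness (from T-≡ e)

  ≟-refl : (x : Fin n) → ⌊ x ≟ x ⌋ ≡ true
  ≟-refl x = to T-≡ (fromWitness refl)

  hits⇒≡just : ∀ {m : Maybe (Fin n)} {w} → hits m w ≡ true → m ≡ just w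
  hits⇒≡just {just x} e = cong just (≟⇒≡ e)

firstUninformed-++ : ∀ {n} {I : Informed n} P Q → All (λ x → I x ≡ true) P →
  firstUninformed I (P ++ Q) ≡ firstUninformed I Q
firstUninformed-++ []      Q []         = refl
firstUninformed-++ (x ∷ P) Q (Ix ∷ IP) rewrite Ix = firstUninformed-++ P Q IP

module FullyAdaptive {n : ℕ} (L : Lists n) where

  faRun-suc : ∀ k I → faRun L (suc k) I ≡ faStep L (faRun L k I)
  faRun-suc zero    I = refl
  faRun-suc (suc k) I = faRun-suc k (faStep L I)

  faStep-keeps : ∀ {I w} → I w ≡ true → faStep L I w ≡ true
  faStep-keeps Iw rewrite Iw = refl

  faStep-sends : ∀ {I v w} → I v ≡ true → firstUninformed I (L v) ≡ just w → faStep L I w ≡ true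
  faStep-sends {I} {v} {w} Iv next =
    trans (cong (I w ∨_) (any-∈ _ (∈-allFin v) v-calls-w)) (∨-zeroʳ (I w))
    where
      v-calls-w : I v ∧ hits (firstUninformed I (L v)) w ≡ true
      v-calls-w rewrite Iv | next = ≟-refl w

  faStep-next : ∀ {I v w} P Q → L v ≡ P ++ w ∷ Q → I v ≡ true → All (λ x → I x ≡ true) P →
    faStep L I w ≡ true
  faStep-next {I} {v} {w} P Q Lv Iv IP = byStatus (I w) refl
    where
      open ≡-Reasoning
      byStatus : ∀ b → I w ≡ b → faStep L I w ≡ true
      byStatus true  Iw = faStep-keeps Iw
      byStatus false Iw = faStep-sends Iv (begin
        firstUninformed I (L v)         ≡⟨ cong (firstUninformed I) Lv ⟩
        firstUninformed I (P ++ w ∷ Q)  ≡⟨ firstUninformed-++ P (w ∷ Q) IP ⟩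
        firstUninformed I (w ∷ Q)       ≡⟨ cong (λ b → if b then firstUninformed I Q else just w) Iw ⟩
        just w                          ∎)

  module Run (I₀ : Informed n) where

    InformedAt : ℕ → Fin n → Set
    InformedAt k w = faRun L k I₀ w ≡ true

    informed-next : ∀ k {v w} P Q → L v ≡ P ++ w ∷ Q → InformedAt k v → All (InformedAt k) P →
      InformedAt (suc k) w
    informed-next k {w = w} P Q Lv Iv IP =
      subst (λ J → J w ≡ true) (sym (faRun-suc k I₀)) (faStep-next P Q Lv Iv IP)

    informed-mono : ∀ {k k′ w} → k ≤ k′ → InformedAt k w → InformedAt k′ w
    informed-mono k≤k′ = mono (≤⇒≤′ k≤k′)
      where
        mono : ∀ {k k′ w} → k ≤′ k′ → InformedAt k w → InformedAt k′ w
        mono (≤′-reflexive refl)           Iw = Iw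
        mono {k} {suc k′} {w} (≤′-step k≤k′) Iw =
          subst (λ J → J w ≡ true) (sym (faRun-suc k′ I₀)) (faStep-keeps (mono k≤k′ Iw))

-- time v is the number of rounds after which v is informed; child p j is the vertex that p informs
-- in round j, counting rounds from 0.
record BroadcastTree {n : ℕ} (G : Graph n) (root : Fin n) (t : ℕ) : Set where
  field
    time            : Fin n → ℕ
    parent          : Fin n → Maybe (Fin n)
    child           : Fin n → ℕ → Maybe (Fin n)
    time-≤          : ∀ v → time v ≤ t
    orphan⇒root     : ∀ {v} → parent v ≡ nothing → v ≡ root
    parent-earlier  : ∀ {v p} → parent v ≡ just p → time p < time v
    parent-adjacent : ∀ {v p} → parent v ≡ just p → adj G p v ≡ true
    child⇒parent    : ∀ {p j w} → child p j ≡ just w → parent w ≡ just p × time w ≡ suc j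
    parent⇒child    : ∀ {p w} → parent w ≡ just p → ∃[ j ] time w ≡ suc j × child p j ≡ just w

module TreeBroadcast {n : ℕ} {G : Graph n} {root : Fin n} {t : ℕ} (T : BroadcastTree G root t) where
  open BroadcastTree T

  kids : Fin n → List (Fin n)
  kids p = mapMaybe (child p) (upTo t)

  treeLists : Lists n
  treeLists p = fromMaybe (parent p) ++ kids p

  kids-all : ∀ {P : Fin n → Set} p → (∀ {w} → parent w ≡ just p → P w) → All P (kids p)
  kids-all p ok =
    All-mapMaybe⁺ (child p) (λ _ pj → ok (proj₁ (child⇒parent pj))) (All.universal-U (upTo t))

  kids-sorted : ∀ p → AllPairs (_<_ on time) (kids p)
  kids-sorted p =
    AllPairs-mapMaybe⁺ (child p) increasing (AllPairs.applyUpTo⁺₁ (λ j → j) t (λ i<j _ → i<j))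
    where
      increasing : ∀ {i j x y} → i < j → child p i ≡ just x → child p j ≡ just y → time x < time y
      increasing i<j pi pj with _ , ti ← child⇒parent pi | _ , tj ← child⇒parent pj =
        subst₂ _<_ (sym ti) (sym tj) (s≤s i<j)

  treeLists-sorted : ∀ p → AllPairs (_<_ on time) (treeLists p)
  treeLists-sorted p with parent p in pp
  ... | nothing = kids-sorted p
  ... | just q  = kids-all p (<-trans (parent-earlier pp) ∘ parent-earlier) ∷ kids-sorted p

  treeLists-adjacent : ∀ p → All (λ w → adj G p w ≡ true) (treeLists p)
  treeLists-adjacent p = All.++⁺ toParent (kids-all p parent-adjacent)
    where
      toParent : All (λ w → adj G p w ≡ true) (fromMaybe (parent p))
      toParent with parent p in pp
      ... | nothing = []
      ... | just q  = trans (Graph.sym G p q) (parent-adjacent pp) ∷ []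

  treeLists-valid : ValidLists G treeLists
  treeLists-valid p =
    AllPairs.map (λ lt eq → <-irrefl (cong time eq) lt) (treeLists-sorted p) , treeLists-adjacent p

  child-∈-treeLists : ∀ {p w} → parent w ≡ just p → w ∈ treeLists p
  child-∈-treeLists {p} {w} pw with j , tw , pj ← parent⇒child pw =
    Any.++⁺ʳ (fromMaybe (parent p))
      (∈-mapMaybe⁺ (child p) (∈-upTo⁺ (subst (_≤ t) tw (time-≤ w))) pj)

  module FromSource (s : Fin n) where
    open FullyAdaptive treeLists
    open Run (only s)

    parent-informed : ∀ {k u p} → parent u ≡ just p → InformedAt k u → InformedAt (suc k) p
    parent-informed {k} {u} pu Iu =
      informed-next k [] (kids u) (cong (λ q → fromMaybe q ++ kids u) pu) Iu []

    reaches-root : ∀ {k} u → Acc (_<_ on time) u → InformedAt k u → InformedAt (k + time u) root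
    reaches-root {k} u (acc earlier) Iu with parent u in pu
    ... | nothing =
      subst (InformedAt (k + time u)) (orphan⇒root pu) (informed-mono (m≤m+n k (time u)) Iu)
    ... | just p  = informed-mono (+-monoʳ-< k (parent-earlier pu))
                      (reaches-root {suc k} p (earlier (parent-earlier pu)) (parent-informed {k} pu Iu))

    root-informed : InformedAt t root
    root-informed =
      informed-mono (time-≤ s) (reaches-root {0} s (On.wellFounded time <-wellFounded s) (≟-refl s))

    informed-by : ∀ j v → time v ≤ j → InformedAt (t + j) v
    informed-by j v tv with parent v in pv
    ... | nothing =
      subst (InformedAt (t + j)) (sym (orphan⇒root pv)) (informed-mono (m≤m+n t j) root-informed)
    informed-by zero    v tv | just p = ⊥-elim (n≮0 (<-≤-trans (parent-earlier pv) tv))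
    informed-by (suc j) v tv | just p with P , Q , split ← ∈-∃++ (child-∈-treeLists pv) =
      subst (λ k → InformedAt k v) (sym (+-suc t j))
        (informed-next (t + j) P Q split (before (parent-earlier pv))
          (All.map before (AllPairs-before P (subst (AllPairs _) split (treeLists-sorted p)))))
      where
        before : ∀ {x} → time x < time v → InformedAt (t + j) x
        before lt = informed-by j _ (≤-pred (<-≤-trans lt tv))

    completes : FACompletesWithin treeLists s (2 * t)
    completes w =
      informed-mono (≤-reflexive (cong (t +_) (sym (+-identityʳ t)))) (informed-by t w (time-≤ w))

  fullyAdaptive : FABroadcastTimeAtMost G (2 * t)
  fullyAdaptive = treeLists , treeLists-valid , FromSource.completes

module ProtocolTree {n : ℕ} (G : Graph n) where

  caller : Round n → Informed n → Fin n → Maybe (Fin n)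
  caller r I w = findᵇ (λ v → I v ∧ hits (r v) w) (allFin n)

  caller-sound : ∀ r I w {v} → caller r I w ≡ just v → I v ≡ true × r v ≡ just w
  caller-sound r I w e
    with Iv , hit ← ∧≡true⁻ (findᵇ-sound (λ u → I u ∧ hits (r u) w) (allFin n) e) =
    Iv , hits⇒≡just hit

  caller-informs : ∀ r I w {v} → caller r I w ≡ just v → step r I w ≡ true
  caller-informs r I w {v} e with Iv , rv ← caller-sound r I w e =
    trans (cong (I w ∨_) (any-∈ _ (∈-allFin v) called)) (∨-zeroʳ (I w))
    where
      called : I v ∧ hits (r v) w ≡ true
      called rewrite Iv | rv = ≟-refl w

  caller-nothing : ∀ r I w → caller r I w ≡ nothing → step r I w ≡ I w
  caller-nothing r I w e =
    trans (cong (I w ∨_) (findᵇ-nothing (λ u → I u ∧ hits (r u) w) (allFin n) e))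
          (∨-identityʳ (I w))

  informTime : ∀ {t} → Vec (Round n) t → Informed n → Fin n → ℕ
  informTime []       I w = 0
  informTime (r ∷ rs) I w = if I w then 0 else suc (informTime rs (step r I) w)

  informer : ∀ {t} → Vec (Round n) t → Informed n → Fin n → Maybe (Fin n)
  informer []       I w = nothing
  informer (r ∷ rs) I w = if I w then nothing else (caller r I w <∣> informer rs (step r I) w)

  roundAt : ∀ {t} → Vec (Round n) t → ℕ → Round n
  roundAt []       j       v = nothing
  roundAt (r ∷ rs) zero    = r
  roundAt (r ∷ rs) (suc j) = roundAt rs j

  -- p's call in round j is a tree edge only if it informs its target for the first time and p is
  -- the caller chosen by informer: several vertices may call the same target in one round.
  informedChild : ∀ {t} → Vec (Round n) t → Informed n → Fin n → ℕ → Maybe (Fin n)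
  informedChild rs I p j = roundAt rs j p >>= λ w →
    when (hits (informer rs I w) p ∧ (informTime rs I w ≡ᵇ suc j)) w

  informTime-≤ : ∀ {t} (rs : Vec (Round n) t) I w → informTime rs I w ≤ t
  informTime-≤ []       I w = z≤n
  informTime-≤ (r ∷ rs) I w with I w
  ... | true  = z≤n
  ... | false = s≤s (informTime-≤ rs (step r I) w)

  informTime-informed : ∀ {t} (rs : Vec (Round n) t) {I w} → I w ≡ true → informTime rs I w ≡ 0
  informTime-informed []       Iw = refl
  informTime-informed (r ∷ rs) Iw rewrite Iw = refl

  informTime-step : ∀ {t} r (rs : Vec (Round n) t) I w →
    informTime (r ∷ rs) I w ≤ suc (informTime rs (step r I) w)
  informTime-step r rs I w with I w
  ... | true  = z≤n
  ... | false = ≤-refl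

  informer-nothing : ∀ {t} (rs : Vec (Round n) t) {I w} →
    informer rs I w ≡ nothing → run rs I w ≡ true → I w ≡ true
  informer-nothing []       _ done = done
  informer-nothing (r ∷ rs) {I} {w} e done with I w in Iw | caller r I w in c
  ... | true  | _      = refl
  ... | false | nothing =
    trans (sym Iw) (trans (sym (caller-nothing r I w c)) (informer-nothing rs e done))

  informer-earlier : ∀ {t} (rs : Vec (Round n) t) {I w v} → informer rs I w ≡ just v →
    informTime rs I v < informTime rs I w
  informer-earlier (r ∷ rs) {I} {w} e with I w | caller r I w in c
  informer-earlier (r ∷ rs) {I} {w} refl | false | just u =
    subst (_< suc _) (sym (informTime-informed (r ∷ rs) (proj₁ (caller-sound r I w c)))) z<s
  ... | false | nothing =
    ≤-<-trans (informTime-step r rs I _) (s≤s (informer-earlier rs e))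

  informer-called : ∀ {t} (rs : Vec (Round n) t) {I w v} → informer rs I w ≡ just v →
    ∃[ j ] informTime rs I w ≡ suc j × roundAt rs j v ≡ just w
  informer-called (r ∷ rs) {I} {w} e with I w | caller r I w in c
  informer-called (r ∷ rs) {I} {w} refl | false | just u =
    0 , cong suc (informTime-informed rs (caller-informs r I w c)) , proj₂ (caller-sound r I w c)
  ... | false | nothing with j , tw , rj ← informer-called rs e = suc j , cong suc tw , rj

  informedChild-sound : ∀ {t} (rs : Vec (Round n) t) {I p j w} → informedChild rs I p j ≡ just w →
    informer rs I w ≡ just p × informTime rs I w ≡ suc j
  informedChild-sound rs {I} {p} {j} e with roundAt rs j p
  ... | just w with hits (informer rs I w) p ∧ (informTime rs I w ≡ᵇ suc j) in ok
  informedChild-sound rs {I} {p} {j} refl | just w | true with isParent , isTime ← ∧≡true⁻ ok =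
    hits⇒≡just isParent , ≡ᵇ⇒≡ _ _ (from T-≡ isTime)

  informedChild-complete : ∀ {t} (rs : Vec (Round n) t) {I p w} → informer rs I w ≡ just p →
    ∃[ j ] informTime rs I w ≡ suc j × informedChild rs I p j ≡ just w
  informedChild-complete rs {I} {p} {w} e with j , tw , rj ← informer-called rs e =
    j , tw , chosen
    where
      chosen : informedChild rs I p j ≡ just w
      chosen rewrite rj | e | tw | ≟-refl p | ≡ᵇ-refl j = refl

  roundAt-valid : ∀ {t} {rs : Vec (Round n) t} →
    Vec.All (ValidRound G) rs → ∀ j → ValidRound G (roundAt rs j)
  roundAt-valid Vec.[]           j       v w ()
  roundAt-valid (valid Vec.∷ _)  zero    = valid
  roundAt-valid (_ Vec.∷ valids) (suc j) = roundAt-valid valids j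

  broadcastTree : ∀ {root t} → BroadcastableIn G root t → BroadcastTree G root t
  broadcastTree {root} (rs , valid , done) = record
    { time            = informTime rs (only root)
    ; parent          = informer rs (only root)
    ; child           = informedChild rs (only root)
    ; time-≤          = informTime-≤ rs (only root)
    ; orphan⇒root     = λ {v} e → sym (≟⇒≡ (informer-nothing rs e (done v)))
    ; parent-earlier  = informer-earlier rs
    ; parent-adjacent = λ e → let j , _ , rj = informer-called rs e in roundAt-valid valid j _ _ rj
    ; child⇒parent    = informedChild-sound rs
    ; parent⇒child    = informedChild-complete rs
    }

broadcastable⇒fullyAdaptive : ∀ {n} (G : Graph n) {root : Fin n} {t : ℕ} →
  BroadcastableIn G root t → FABroadcastTimeAtMost G (2 * t)
broadcastable⇒fullyAdaptive G b = TreeBroadcast.fullyAdaptive (ProtocolTree.broadcastTree G b)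

corollary1 : ∀ {n : ℕ} (G : Graph n) → Connected G →
    ∀ (t : ℕ) → BroadcastTimeAtMost G t → FABroadcastTimeAtMost G (2 * t)
corollary1 {zero}  G _ t _ = (λ ()) , (λ ()) , (λ ())
corollary1 {suc m} G _ t b = broadcastable⇒fullyAdaptive G (b Fin.zero)
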